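{- The set $\mathfrak{I} = \{ I \subseteq \mathbb{3}^X : Ann^{2}(I) = I \}$ of closed sets of $\mathbb{3}^{X}$ with respect to $Ann^{2}$ is a Boolean algebra with respect to the operations \begin{align*} \neg I & = Ann(I) \\ I_{1} \wedge I_{2} & = I_{1} \cap I_{2} \\ I_{1} \vee I_{2} & = Ann( Ann(I_{1}) \cap Ann(I_{2})) \end{align*} and $\{ {\bf U} \}$ and $\mathbb{3}^{X}$ as the constants $0$ and $1$ respectively. Moreover, $\mathfrak{I} \cong \mathbb{2}^{X}$ and is therefore complete.
   Context: $\mathbb{3} = \{T, F, U\}$ is McCarthy's three-valued logic: $\neg T = F$, $\neg F = T$, $\neg U = U$; $T \wedge y = y$, $F \wedge y = F$, $U \wedge y = U$; $T \vee y = T$, $F \vee y = y$, $U \vee y = U$. For a set $X$, $\mathbb{3}^{X}$ carries the pointwise operations, with constant ${\bf U}$ identically $U$; $\mathbb{2}^X$ is the power-set Boolean algebra. For $a \in \mathbb{3}^X$, $Ann(a) = \{ \alpha \in \mathbb{3}^X : (\alpha \wedge a) \vee (\neg \alpha \wedge a) = {\bf U} \}$, and for $S \subseteq \mathbb{3}^X$, $Ann(S) = \bigcap_{a \in S} Ann(a)$; $Ann^2 = Ann \circ Ann$. -}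

module Defs where

open import Level using (0ℓ)
open import Data.Unit using (⊤; tt)
open import Data.Bool using (Bool; true; false; not; _∧_; _∨_)
open import Data.Sum using (_⊎_; inj₁; inj₂)
open import Data.Product using (Σ; ∃; _×_; _,_; proj₁; proj₂)
open import Relation.Binary.PropositionalEquality using (_≡_; refl; _≗_)
open import Relation.Unary using (Pred; _⊆_; _≐_; _∩_)

-- McCarthy's three-valued logic 𝟛 = {T, F, U}

data Three : Set where
  T F U : Three

¬₃_ : Three → Three
¬₃ T = F
¬₃ F = T
¬₃ U = U

_∧₃_ : Three → Three → Three
T ∧₃ y = y
F ∧₃ y = F
U ∧₃ y = U

_∨₃_ : Three → Three → Three
T ∨₃ y = T
F ∨₃ y = y
U ∨₃ y = U

infix  7 ¬₃_
infixr 6 _∧₃_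
infixr 5 _∨₃_

module _ {X : Set} where

  infix  7 ¬ᶠ_
  infixr 6 _∧ᶠ_
  infixr 5 _∨ᶠ_

  ¬ᶠ_ : (X → Three) → (X → Three)
  (¬ᶠ a) x = ¬₃ (a x)

  _∧ᶠ_ : (X → Three) → (X → Three) → (X → Three)
  (a ∧ᶠ b) x = a x ∧₃ b x

  _∨ᶠ_ : (X → Three) → (X → Three) → (X → Three)
  (a ∨ᶠ b) x = a x ∨₃ b x

  𝐔 : X → Three
  𝐔 _ = U


-- Annihilators.  An equation in 𝟛^X is read pointwise.

Ann₁ : {X : Set} → (X → Three) → Pred (X → Three) 0ℓ
Ann₁ a α = ∀ x → ((α ∧ᶠ a) ∨ᶠ (¬ᶠ α ∧ᶠ a)) x ≡ 𝐔 x

Ann : {X : Set} → Pred (X → Three) 0ℓ → Pred (X → Three) 0ℓ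
Ann S α = ∀ a → S a → Ann₁ a α

Ann² : {X : Set} → Pred (X → Three) 0ℓ → Pred (X → Three) 0ℓ
Ann² S = Ann (Ann S)

Closed : {X : Set} → Pred (Pred (X → Three) 0ℓ) _
Closed I = Ann² I ≐ I

private
  pt : Three → Three → Three
  pt a b = (b ∧₃ a) ∨₃ (¬₃ b ∧₃ a)

  pt⇒ : ∀ a b → pt a b ≡ U → a ≡ U ⊎ b ≡ U
  pt⇒ T T ()
  pt⇒ T F ()
  pt⇒ T U _ = inj₂ refl
  pt⇒ F T ()
  pt⇒ F F ()
  pt⇒ F U _ = inj₂ refl
  pt⇒ U b _ = inj₁ refl

  ⇒pt : ∀ a b → a ≡ U ⊎ b ≡ U → pt a b ≡ U
  ⇒pt U T _ = refl
  ⇒pt U F _ = refl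
  ⇒pt U U _ = refl
  ⇒pt T U _ = refl
  ⇒pt F U _ = refl
  ⇒pt T T (inj₁ ())
  ⇒pt T T (inj₂ ())
  ⇒pt T F (inj₁ ())
  ⇒pt T F (inj₂ ())
  ⇒pt F T (inj₁ ())
  ⇒pt F T (inj₂ ())
  ⇒pt F F (inj₁ ())
  ⇒pt F F (inj₂ ())

  swap⊎ : {A B : Set} → A ⊎ B → B ⊎ A
  swap⊎ (inj₁ a) = inj₂ a
  swap⊎ (inj₂ b) = inj₁ b

module _ {X : Set} where

  Ann₁-sym : ∀ (a α : X → Three) → Ann₁ a α → Ann₁ α a
  Ann₁-sym a α p x = ⇒pt (α x) (a x) (swap⊎ (pt⇒ (a x) (α x) (p x)))

  Ann-unit : ∀ (S : Pred (X → Three) 0ℓ) → S ⊆ Ann² S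
  Ann-unit S {α} α∈S β β∈AnnS = Ann₁-sym α β (β∈AnnS α α∈S)

  Ann-anti : ∀ {S R : Pred (X → Three) 0ℓ} → S ⊆ R → Ann R ⊆ Ann S
  Ann-anti S⊆R α∈AnnR a a∈S = α∈AnnR a (S⊆R a∈S)

  Ann-closed : ∀ (S : Pred (X → Three) 0ℓ) → Closed (Ann S)
  Ann-closed S =
      (λ {α} α∈ → Ann-anti {S} {Ann² S} (λ {β} → Ann-unit S {β}) {α} α∈)
    , (λ {α} α∈ → Ann-unit (Ann S) {α} α∈)

  ∩-closed : ∀ {I J : Pred (X → Three) 0ℓ} → Closed I → Closed J → Closed (I ∩ J)
  ∩-closed {I} {J} cI cJ =
      (λ {α} α∈ →
          proj₁ cI {α} (Ann-anti {Ann I} {Ann (I ∩ J)}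
             (λ {β} → Ann-anti {I ∩ J} {I} (λ {γ} p → proj₁ p) {β}) {α} α∈)
        , proj₁ cJ {α} (Ann-anti {Ann J} {Ann (I ∩ J)}
             (λ {β} → Ann-anti {I ∩ J} {J} (λ {γ} p → proj₂ p) {β}) {α} α∈))
    , (λ {α} α∈ → Ann-unit (I ∩ J) {α} α∈)

  ｛𝐔｝ : Pred (X → Three) 0ℓ
  ｛𝐔｝ α = ∀ x → α x ≡ 𝐔 x

  Full : Pred (X → Three) 0ℓ
  Full _ = ⊤

  private
    𝐓 : X → Three
    𝐓 _ = T

    TU : ∀ {b} → T ≡ U ⊎ b ≡ U → b ≡ U
    TU (inj₁ ())
    TU (inj₂ e) = e

  ｛𝐔｝-closed : Closed ｛𝐔｝
  ｛𝐔｝-closed =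
      (λ {α} α∈ x → TU (pt⇒ (𝐓 x) (α x)
         (α∈ 𝐓 (λ a a∈ y → ⇒pt (a y) T (inj₁ (a∈ y))) x)))
    , (λ {α} α∈ → Ann-unit ｛𝐔｝ {α} α∈)

  Full-closed : Closed Full
  Full-closed =
      (λ _ → tt)
    , (λ {α} _ β β∈ x → ⇒pt (β x) (α x)
         (inj₁ (TU (pt⇒ (𝐓 x) (β x) (β∈ 𝐓 tt x)))))

𝔍 : Set → Set₁
𝔍 X = Σ (Pred (X → Three) 0ℓ) Closed

module _ {X : Set} where

  _≈𝔍_ : 𝔍 X → 𝔍 X → Set
  I ≈𝔍 J = proj₁ I ≐ proj₁ J

  ¬𝔍_ : 𝔍 X → 𝔍 X
  ¬𝔍 I = Ann (proj₁ I) , Ann-closed (proj₁ I)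

  _∧𝔍_ : 𝔍 X → 𝔍 X → 𝔍 X
  I ∧𝔍 J = (proj₁ I ∩ proj₁ J) , ∩-closed (proj₂ I) (proj₂ J)

  _∨𝔍_ : 𝔍 X → 𝔍 X → 𝔍 X
  I ∨𝔍 J = Ann (Ann (proj₁ I) ∩ Ann (proj₁ J))
         , Ann-closed (Ann (proj₁ I) ∩ Ann (proj₁ J))

  0𝔍 : 𝔍 X
  0𝔍 = ｛𝐔｝ , ｛𝐔｝-closed

  1𝔍 : 𝔍 X
  1𝔍 = Full , Full-closed

  _≤𝔍_ : 𝔍 X → 𝔍 X → Set
  I ≤𝔍 J = (I ∧𝔍 J) ≈𝔍 I

record IsBAIsoTo2^X {X : Set} (f : 𝔍 X → (X → Bool)) : Set₁ where
  field
    cong      : ∀ {I J} → I ≈𝔍 J → f I ≗ f J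
    injective : ∀ {I J} → f I ≗ f J → I ≈𝔍 J
    surjective : ∀ (g : X → Bool) → ∃ λ I → f I ≗ g
    hom-¬     : ∀ I → f (¬𝔍 I) ≗ (λ x → not (f I x))
    hom-∧     : ∀ I J → f (I ∧𝔍 J) ≗ (λ x → f I x ∧ f J x)
    hom-∨     : ∀ I J → f (I ∨𝔍 J) ≗ (λ x → f I x ∨ f J x)
    hom-0     : f 0𝔍 ≗ (λ _ → false)
    hom-1     : f 1𝔍 ≗ (λ _ → true)

IsSup : {X : Set} {J : Set} → (J → 𝔍 X) → 𝔍 X → Set₁
IsSup {X} {J} Fam S = (∀ j → Fam j ≤𝔍 S) × (∀ (R : 𝔍 X) → (∀ j → Fam j ≤𝔍 R) → S ≤𝔍 R)

IsInf : {X : Set} {J : Set} → (J → 𝔍 X) → 𝔍 X → Set₁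
IsInf {X} {J} Fam S = (∀ j → S ≤𝔍 Fam j) × (∀ (R : 𝔍 X) → (∀ j → R ≤𝔍 Fam j) → R ≤𝔍 S)

Complete𝔍 : Set → Set₁
Complete𝔍 X = ∀ (J : Set) (Fam : J → 𝔍 X) → (∃ λ S → IsSup Fam S) × (∃ λ S → IsInf Fam S)

module Submission where

-- Everything rests on one observation: α ∈ Ann(a) says exactly that α and a
-- are *orthogonal*, i.e. at every point at least one of them is U.  Ann is
-- therefore the polarity of a symmetric relation, which gives a Galois
-- connection; the closed sets are then a complete lattice with meet ∩ and
-- join Ann(Ann I ∩ Ann J), and Ann I is a complement of I because only the
-- constant 𝐔 is orthogonal to itself.  Distributivity uses the extra
-- structure of 𝟛^X: restricting α to the support of β (the very term
-- (β ∧ α) ∨ (¬β ∧ α) occurring in Ann) stays inside every annihilator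
-- containing α.  Finally, assuming excluded middle, a closed set
-- is determined by its support {x : some member is not U at x}, and sending
-- a closed set to its support is the Boolean isomorphism onto 𝟚^X.

open import Defs
open import Level using (0ℓ) renaming (suc to lsuc)
open import Data.Bool using (Bool; true; false; not; _∧_; _∨_; T?)
open import Data.Bool.Properties using (∨-∧-booleanAlgebra; not-involutive)
open import Data.Empty using (⊥-elim)
open import Data.Product using (∃; _×_; _,_; proj₁; proj₂)
open import Data.Sum using (_⊎_; inj₁; inj₂)
open import Data.Unit using (tt)
open import Function.Bundles using (_⇔_; mk⇔; module Equivalence)
open import Function.Properties.Equivalence using () renaming (trans to ⇔-trans)
open import Relation.Nullary using (¬_; Dec; yes; no; does; ¬?; _×-dec_)
open import Relation.Nullary.Decidable using (does-⇔; dec-true; dec-false)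
open import Relation.Binary.PropositionalEquality using (_≡_; _≢_; refl; sym; trans; cong; cong₂; _≗_; module ≡-Reasoning)
open import Relation.Binary.Core using (Rel)
open import Relation.Binary.Structures using (IsPartialOrder)
open import Relation.Binary.Lattice using (DistributiveLattice; Supremum; Infimum)
open import Relation.Unary using (Pred; Decidable; _⊆_; _∩_; ⋂; ｛_｝)
open import Relation.Unary.Properties using (⊆-reflexive; ⊆-trans; ⊆-antisym; ≐-refl; ≐-sym; ≐-trans)
open import Axiom.ExcludedMiddle using (ExcludedMiddle)
open import Algebra.Lattice.Structures using (IsBooleanAlgebra)
open import Algebra.Lattice.Properties.BooleanAlgebra ∨-∧-booleanAlgebra using (deMorgan₁)
import Algebra.Lattice.Structures.Biased as Biased
import Relation.Binary.Lattice.Properties.Lattice as LatticeProperties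
import Relation.Binary.Lattice.Properties.DistributiveLattice as DistributiveLatticeProperties

open Equivalence using (to; from)

-- The term (p ∧ q) ∨ (¬p ∧ q) of the annihilator condition: q restricted to
-- the support of p.  It is U exactly when p or q is.
_⊓₃_ : Three → Three → Three
p ⊓₃ q = (p ∧₃ q) ∨₃ (¬₃ p ∧₃ q)

⊓₃-U : ∀ p q → p ⊓₃ q ≡ U ⇔ (p ≡ U ⊎ q ≡ U)
⊓₃-U p q = mk⇔ (forward p q) (backward p q)
  where
    forward : ∀ p q → p ⊓₃ q ≡ U → p ≡ U ⊎ q ≡ U
    forward U q _  = inj₁ refl
    forward F q e  = inj₂ e
    forward T U _  = inj₂ refl
    forward T T ()
    forward T F ()

    backward : ∀ p q → p ≡ U ⊎ q ≡ U → p ⊓₃ q ≡ U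
    backward U q _          = refl
    backward T U _          = refl
    backward F U _          = refl
    backward T T (inj₁ ())
    backward T T (inj₂ ())
    backward T F (inj₁ ())
    backward T F (inj₂ ())
    backward F T (inj₁ ())
    backward F T (inj₂ ())
    backward F F (inj₁ ())
    backward F F (inj₂ ())

U? : (p : Three) → Dec (p ≡ U)
U? T = no λ ()
U? F = no λ ()
U? U = yes refl

mark : Bool → Three
mark true  = U
mark false = T

mark-U : {P : Set} (P? : Dec P) → mark (does P?) ≡ U ⇔ P
mark-U (yes p) = mk⇔ (λ _ → p) (λ _ → refl)
mark-U (no ¬p) = mk⇔ (λ ()) (λ p → ⊥-elim (¬p p))

not-∧-not : ∀ a b → not (not a ∧ not b) ≡ a ∨ b
not-∧-not a b = trans (deMorgan₁ (not a) (not b)) (cong₂ _∨_ (not-involutive a) (not-involutive b))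

does-transport : {P Q : Set} (P? : Dec P) (Q? : Dec Q) → does P? ≡ does Q? → P → Q
does-transport _        (yes q) _  _ = q
does-transport (yes _)  (no _)  () _
does-transport (no ¬p)  (no _)  _  p = ⊥-elim (¬p p)

module _ {X : Set} where

  𝟛^X : Set
  𝟛^X = X → Three

  Subset : Set₁
  Subset = Pred 𝟛^X 0ℓ

  _⊥_ : 𝟛^X → 𝟛^X → Set
  a ⊥ b = ∀ x → a x ≡ U ⊎ b x ≡ U

  ⊥-sym : ∀ {a b} → a ⊥ b → b ⊥ a
  ⊥-sym a⊥b x with a⊥b x
  ... | inj₁ e = inj₂ e
  ... | inj₂ e = inj₁ e

  ⊥-defined : ∀ {a b x} → a ⊥ b → b x ≢ U → a x ≡ U
  ⊥-defined {x = x} a⊥b b≢U with a⊥b x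
  ... | inj₁ e = e
  ... | inj₂ e = ⊥-elim (b≢U e)

  ⊥-self : ∀ {a} → a ⊥ a → ∀ x → a x ≡ U
  ⊥-self a⊥a x with a⊥a x
  ... | inj₁ e = e
  ... | inj₂ e = e

  Ann→⊥ : ∀ {S : Subset} {α a} → Ann S α → S a → α ⊥ a
  Ann→⊥ {α = α} {a} α∈AnnS a∈S x = to (⊓₃-U (α x) (a x)) (α∈AnnS a a∈S x)

  ⊥→Ann : ∀ {S : Subset} {α} → (∀ {a} → S a → α ⊥ a) → Ann S α
  ⊥→Ann {α = α} orth a a∈S x = from (⊓₃-U (α x) (a x)) (orth a∈S x)

  Ann-galois : ∀ {S R : Subset} → S ⊆ Ann R → R ⊆ Ann S
  Ann-galois {S} {R} S⊆AnnR {r} r∈R = ⊥→Ann {S} {r} λ {s} s∈S → ⊥-sym (Ann→⊥ {R} {s} (S⊆AnnR s∈S) r∈R)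

  Ann-least : ∀ {S R : Subset} → Closed R → Ann R ⊆ S → Ann S ⊆ R
  Ann-least {S} {R} closedR AnnR⊆S {α} α∈AnnS = proj₁ closedR {α} (Ann-anti {S = Ann R} {R = S} AnnR⊆S {α} α∈AnnS)

  Ann-disjoint : ∀ {S : Subset} {α} → S α → Ann S α → ∀ x → α x ≡ U
  Ann-disjoint {S} {α} α∈S α∈AnnS = ⊥-self (Ann→⊥ {S} {α} α∈AnnS α∈S)

  ｛𝐔｝⊆Ann : ∀ {S : Subset} → ｛𝐔｝ ⊆ Ann S
  ｛𝐔｝⊆Ann {S} {α} α≡𝐔 = ⊥→Ann {S} {α} λ _ x → inj₁ (α≡𝐔 x)

  ⋂-closed : ∀ {J : Set} (I : J → Subset) → (∀ j → Closed (I j)) → Closed (⋂ J I)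
  ⋂-closed {J} I closed =
      (λ {α} α∈Ann² j → proj₁ (closed j) {α}
         (Ann-anti {S = Ann (I j)} {R = Ann (⋂ J I)}
            (λ {β} → Ann-anti {S = ⋂ J I} {R = I j} (λ α∈⋂ → α∈⋂ j) {β}) {α} α∈Ann²))
    , Ann-unit (⋂ J I)

  _≼_ : 𝟛^X → 𝟛^X → Set
  a ≼ b = ∀ x → b x ≡ U → a x ≡ U

  DownClosed : Subset → Set
  DownClosed I = ∀ {a b} → a ≼ b → I b → I a

  Ann-downClosed : ∀ (S : Subset) → DownClosed (Ann S)
  Ann-downClosed S {a} {b} a≼b b∈AnnS = ⊥→Ann {S} {a} λ {s} s∈S x → shrink {s} x (Ann→⊥ {S} {b} b∈AnnS s∈S x)
    where
      shrink : ∀ {s} x → b x ≡ U ⊎ s x ≡ U → a x ≡ U ⊎ s x ≡ U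
      shrink x (inj₁ e) = inj₁ (a≼b x e)
      shrink x (inj₂ e) = inj₂ e

  Closed-downClosed : ∀ {I : Subset} → Closed I → DownClosed I
  Closed-downClosed {I} closedI a≼b b∈I =
    proj₁ closedI (Ann-downClosed (Ann I) a≼b (proj₂ closedI b∈I))

  _⊓_ : 𝟛^X → 𝟛^X → 𝟛^X
  (a ⊓ b) x = a x ⊓₃ b x

  ⊓-≼ˡ : ∀ a b → (a ⊓ b) ≼ a
  ⊓-≼ˡ a b x e = from (⊓₃-U (a x) (b x)) (inj₁ e)

  ⊓-≼ʳ : ∀ a b → (a ⊓ b) ≼ b
  ⊓-≼ʳ a b x e = from (⊓₃-U (a x) (b x)) (inj₂ e)

  ⊓-defined : ∀ a b {x} → a x ≢ U → b x ≢ U → (a ⊓ b) x ≢ U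
  ⊓-defined a b {x} a≢U b≢U e with to (⊓₃-U (a x) (b x)) e
  ... | inj₁ a≡U = a≢U a≡U
  ... | inj₂ b≡U = b≢U b≡U

  ⊓-shift : ∀ α β j → β ⊥ (α ⊓ j) → (α ⊓ β) ⊥ j
  ⊓-shift α β j β⊥αj x with β⊥αj x
  ... | inj₁ β≡U = inj₁ (⊓-≼ʳ α β x β≡U)
  ... | inj₂ αj≡U with to (⊓₃-U (α x) (j x)) αj≡U
  ...   | inj₁ α≡U = inj₁ (⊓-≼ˡ α β x α≡U)
  ...   | inj₂ j≡U = inj₂ j≡U

  ⊓-self : ∀ α β → α ⊥ (α ⊓ β) → α ⊥ β
  ⊓-self α β α⊥αβ x with α⊥αβ x
  ... | inj₁ α≡U = inj₁ α≡U
  ... | inj₂ αβ≡U = to (⊓₃-U (α x) (β x)) αβ≡U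

  restrict-into-Ann : ∀ {I J : Subset} → DownClosed I → DownClosed J →
    ∀ {α β} → I α → Ann (I ∩ J) β → Ann J (α ⊓ β)
  restrict-into-Ann {I} {J} downI downJ {α} {β} α∈I β∈Ann =
    ⊥→Ann {J} λ {j} j∈J → ⊓-shift α β j
      (Ann→⊥ {I ∩ J} β∈Ann (downI (⊓-≼ˡ α j) α∈I , downJ (⊓-≼ʳ α j) j∈J))

  ∩-distrib-join : ∀ {I J K : Subset} → DownClosed I → DownClosed J → DownClosed K →
    I ∩ Ann (Ann J ∩ Ann K) ⊆ Ann (Ann (I ∩ J) ∩ Ann (I ∩ K))
  ∩-distrib-join {I} {J} {K} downI downJ downK {α} (α∈I , α∈J∨K) =
    ⊥→Ann {Ann (I ∩ J) ∩ Ann (I ∩ K)} λ {β} (β∈AnnIJ , β∈AnnIK) →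
      ⊓-self α β (Ann→⊥ {Ann J ∩ Ann K} α∈J∨K
        ( restrict-into-Ann {I} {J} downI downJ α∈I β∈AnnIJ
        , restrict-into-Ann {I} {K} downI downK α∈I β∈AnnIK))

  _⊑_ : Rel (𝔍 X) 0ℓ
  I ⊑ J = proj₁ I ⊆ proj₁ J

  ⊑-isPartialOrder : IsPartialOrder _≈𝔍_ _⊑_
  ⊑-isPartialOrder = record
    { isPreorder = record
      { isEquivalence = record { refl = ≐-refl ; sym = ≐-sym ; trans = ≐-trans }
      ; reflexive     = ⊆-reflexive
      ; trans         = ⊆-trans
      }
    ; antisym = ⊆-antisym
    }

  closedness : (I : 𝔍 X) → Closed (proj₁ I)
  closedness = proj₂

  ∨𝔍-upperˡ : ∀ I J → I ⊑ (I ∨𝔍 J)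
  ∨𝔍-upperˡ I J = Ann-galois {Ann (proj₁ I) ∩ Ann (proj₁ J)} {proj₁ I} proj₁

  ∨𝔍-upperʳ : ∀ I J → J ⊑ (I ∨𝔍 J)
  ∨𝔍-upperʳ I J = Ann-galois {Ann (proj₁ I) ∩ Ann (proj₁ J)} {proj₁ J} proj₂

  ∨𝔍-least : ∀ I J R → I ⊑ R → J ⊑ R → (I ∨𝔍 J) ⊑ R
  ∨𝔍-least I J R I⊑R J⊑R = Ann-least {Ann (proj₁ I) ∩ Ann (proj₁ J)} {proj₁ R} (closedness R)
    λ {β} β∈AnnR → Ann-anti {S = proj₁ I} {R = proj₁ R} I⊑R {β} β∈AnnR
                 , Ann-anti {S = proj₁ J} {R = proj₁ R} J⊑R {β} β∈AnnR

  ∨𝔍-supremum : Supremum _⊑_ _∨𝔍_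
  ∨𝔍-supremum I J = ∨𝔍-upperˡ I J , ∨𝔍-upperʳ I J , ∨𝔍-least I J

  ∧𝔍-infimum : Infimum _⊑_ _∧𝔍_
  ∧𝔍-infimum I J = proj₁ , proj₂ , λ R R⊑I R⊑J α∈R → R⊑I α∈R , R⊑J α∈R

  -- Distributivity: one inclusion is ∩-distrib-join, the other holds in
  -- every lattice.
  ∧𝔍-distribˡ-∨𝔍 : ∀ I J K → (I ∧𝔍 (J ∨𝔍 K)) ≈𝔍 ((I ∧𝔍 J) ∨𝔍 (I ∧𝔍 K))
  ∧𝔍-distribˡ-∨𝔍 I J K =
      ∩-distrib-join {proj₁ I} {proj₁ J} {proj₁ K}
        (Closed-downClosed (closedness I)) (Closed-downClosed (closedness J)) (Closed-downClosed (closedness K))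
    , ∨𝔍-least (I ∧𝔍 J) (I ∧𝔍 K) (I ∧𝔍 (J ∨𝔍 K))
        (λ (α∈I , α∈J) → α∈I , ∨𝔍-upperˡ J K α∈J)
        (λ (α∈I , α∈K) → α∈I , ∨𝔍-upperʳ J K α∈K)

  𝔍-distributiveLattice : DistributiveLattice (lsuc 0ℓ) 0ℓ 0ℓ
  𝔍-distributiveLattice = record
    { Carrier = 𝔍 X
    ; _≈_     = _≈𝔍_
    ; _≤_     = _⊑_
    ; _∨_     = _∨𝔍_
    ; _∧_     = _∧𝔍_
    ; isDistributiveLattice = record
      { isLattice = record
        { isPartialOrder = ⊑-isPartialOrder
        ; supremum       = ∨𝔍-supremum
        ; infimum        = ∧𝔍-infimum
        }
      ; ∧-distribˡ-∨ = ∧𝔍-distribˡ-∨𝔍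
      }
    }

  𝔍-isBooleanAlgebra : IsBooleanAlgebra (_≈𝔍_ {X}) _∨𝔍_ _∧𝔍_ ¬𝔍_ 1𝔍 0𝔍
  𝔍-isBooleanAlgebra = Biased.isBooleanAlgebraʳ record
    { isDistributiveLattice = record
      { isLattice   = LatticeProperties.isAlgLattice (DistributiveLattice.lattice 𝔍-distributiveLattice)
      ; ∨-distrib-∧ = DistributiveLatticeProperties.∨-distrib-∧ 𝔍-distributiveLattice
      ; ∧-distrib-∨ = DistributiveLatticeProperties.∧-distrib-∨ 𝔍-distributiveLattice
      }
    ; ∨-complementʳ = λ I →
          (λ _ → tt)
        , λ {α} _ → ⊥→Ann {Ann (proj₁ I) ∩ Ann (Ann (proj₁ I))} {α}
            λ {β} (β∈AnnI , β∈Ann²I) x → inj₂ (Ann-disjoint {Ann (proj₁ I)} {β} β∈AnnI β∈Ann²I x)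
    ; ∧-complementʳ = λ I →
          (λ {α} (α∈I , α∈AnnI) → Ann-disjoint {proj₁ I} {α} α∈I α∈AnnI)
        , λ {α} α≡𝐔 → proj₁ (closedness I) {α} (｛𝐔｝⊆Ann {Ann (proj₁ I)} {α} α≡𝐔) , ｛𝐔｝⊆Ann {proj₁ I} {α} α≡𝐔
    ; ¬-cong = λ {I} {J} (I⊆J , J⊆I) →
        (λ {α} → Ann-anti {S = proj₁ J} {R = proj₁ I} J⊆I {α}) , (λ {α} → Ann-anti {S = proj₁ I} {R = proj₁ J} I⊆J {α})
    }

  ⊑⇒≤𝔍 : ∀ I J → I ⊑ J → I ≤𝔍 J
  ⊑⇒≤𝔍 I J I⊑J = proj₁ , λ α∈I → α∈I , I⊑J α∈I

  ≤𝔍⇒⊑ : ∀ I J → I ≤𝔍 J → I ⊑ J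
  ≤𝔍⇒⊑ I J (_ , I⊆I∩J) α∈I = proj₂ (I⊆I∩J α∈I)

  ⋁ : ∀ {J : Set} → (J → 𝔍 X) → 𝔍 X
  ⋁ {J} I = Ann (⋂ J λ j → Ann (proj₁ (I j))) , Ann-closed _

  ⋀ : ∀ {J : Set} → (J → 𝔍 X) → 𝔍 X
  ⋀ {J} I = ⋂ J (λ j → proj₁ (I j)) , ⋂-closed (λ j → proj₁ (I j)) (λ j → closedness (I j))

  ⋁-isSup : ∀ {J : Set} (I : J → 𝔍 X) → IsSup I (⋁ I)
  ⋁-isSup {J} I =
      (λ j → ⊑⇒≤𝔍 (I j) (⋁ I) (Ann-galois {⋂ J λ j → Ann (proj₁ (I j))} {proj₁ (I j)} λ β∈⋂ → β∈⋂ j))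
    , λ R I≤R → ⊑⇒≤𝔍 (⋁ I) R (Ann-least {⋂ J λ j → Ann (proj₁ (I j))} {proj₁ R} (closedness R)
        λ {β} β∈AnnR j → Ann-anti {S = proj₁ (I j)} {R = proj₁ R} (≤𝔍⇒⊑ (I j) R (I≤R j)) {β} β∈AnnR)

  ⋀-isInf : ∀ {J : Set} (I : J → 𝔍 X) → IsInf I (⋀ I)
  ⋀-isInf I =
      (λ j → ⊑⇒≤𝔍 (⋀ I) (I j) λ α∈⋂ → α∈⋂ j)
    , λ R R≤I → ⊑⇒≤𝔍 R (⋀ I) λ α∈R j → ≤𝔍⇒⊑ R (I j) (R≤I j) α∈R

  𝔍-complete : Complete𝔍 X
  𝔍-complete J I = (⋁ I , ⋁-isSup I) , (⋀ I , ⋀-isInf I)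

  Supp : Subset → Pred X 0ℓ
  Supp S x = ∃ λ a → S a × a x ≢ U

  Supp-mono : ∀ {S R : Subset} → S ⊆ R → Supp S ⊆ Supp R
  Supp-mono S⊆R (a , a∈S , a≢U) = a , S⊆R a∈S , a≢U

  ⊆-from-Supp : ∀ {I J : Subset} → Closed J → Supp I ⊆ Supp J → I ⊆ J
  ⊆-from-Supp {I} {J} closedJ SuppI⊆SuppJ {α} α∈I =
    proj₁ closedJ {α} (⊥→Ann {Ann J} {α} λ {β} β∈AnnJ x → orth {β} β∈AnnJ x (U? (α x)))
    where
      orth : ∀ {β} → Ann J β → ∀ x → Dec (α x ≡ U) → α x ≡ U ⊎ β x ≡ U
      orth _      x (yes α≡U) = inj₁ α≡U
      orth {β} β∈AnnJ x (no α≢U)  =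
        let (a , a∈J , a≢U) = SuppI⊆SuppJ (α , α∈I , α≢U)
        in  inj₂ (⊥-defined (Ann→⊥ {J} {β} {a} β∈AnnJ a∈J) a≢U)

  Supp-Ann-disjoint : ∀ {S : Subset} {x} → Supp (Ann S) x → ¬ Supp S x
  Supp-Ann-disjoint {S} (α , α∈AnnS , α≢U) (a , a∈S , a≢U) =
    α≢U (⊥-defined (Ann→⊥ {S} {α} {a} α∈AnnS a∈S) a≢U)

  undefinedOn : ∀ {Z : Pred X 0ℓ} → Decidable Z → 𝟛^X
  undefinedOn Z? y = mark (does (Z? y))

  Supp-Ann-intro : ∀ {S : Subset} {Z : Pred X 0ℓ} (Z? : Decidable Z) →
    Supp S ⊆ Z → ∀ {x} → ¬ Z x → Supp (Ann S) x
  Supp-Ann-intro {S} {Z} Z? SuppS⊆Z {x} x∉Z =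
    undefinedOn Z? , ⊥→Ann {S} {undefinedOn Z?} orth , λ e → x∉Z (to (mark-U (Z? x)) e)
    where
      orth : ∀ {a} → S a → undefinedOn Z? ⊥ a
      orth {a} a∈S y with U? (a y)
      ... | yes a≡U = inj₂ a≡U
      ... | no a≢U  = inj₁ (from (mark-U (Z? y)) (SuppS⊆Z (a , a∈S , a≢U)))

  Supp-Ann-singleton : ∀ (χ : 𝟛^X) {x} → Supp (Ann ｛ χ ｝) x ⇔ χ x ≡ U
  Supp-Ann-singleton χ {x} = mk⇔
    (λ (α , α∈Ann , α≢U) → ⊥-defined (⊥-sym (Ann→⊥ {｛ χ ｝} {α} {χ} α∈Ann refl)) α≢U)
    (λ χ≡U → Supp-Ann-intro {｛ χ ｝} (λ y → ¬? (U? (χ y)))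
               (λ { (a , refl , a≢U) → a≢U }) (λ χ≢U → χ≢U χ≡U))

  Supp-∩ : ∀ {I J : Subset} → DownClosed I → DownClosed J → ∀ {x} →
    Supp (I ∩ J) x ⇔ (Supp I x × Supp J x)
  Supp-∩ {I} {J} downI downJ = mk⇔
    (λ s → Supp-mono proj₁ s , Supp-mono proj₂ s)
    (λ ((a , a∈I , a≢U) , (b , b∈J , b≢U)) →
      a ⊓ b , (downI (⊓-≼ˡ a b) a∈I , downJ (⊓-≼ʳ a b) b∈J) , ⊓-defined a b a≢U b≢U)

  module Representation (lem : ExcludedMiddle 0ℓ) where

    support : 𝔍 X → X → Bool
    support I x = does (lem {Supp (proj₁ I) x})

    Supp-Ann : ∀ {S : Subset} {x} → Supp (Ann S) x ⇔ (¬ Supp S x)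
    Supp-Ann {S} = mk⇔ Supp-Ann-disjoint (Supp-Ann-intro {S} (λ y → lem) (λ s → s))

    support-¬ : ∀ I → support (¬𝔍 I) ≗ λ x → not (support I x)
    support-¬ I x = does-⇔ (Supp-Ann {proj₁ I}) lem (¬? lem)

    support-∧ : ∀ I J → support (I ∧𝔍 J) ≗ λ x → support I x ∧ support J x
    support-∧ I J x = does-⇔
      (Supp-∩ {proj₁ I} {proj₁ J} (Closed-downClosed (closedness I)) (Closed-downClosed (closedness J)))
      lem (lem ×-dec lem)

    -- The join is the De Morgan dual of the meet, definitionally.
    support-∨ : ∀ I J → support (I ∨𝔍 J) ≗ λ x → support I x ∨ support J x
    support-∨ I J x = begin
      support (¬𝔍 ((¬𝔍 I) ∧𝔍 (¬𝔍 J))) x                ≡⟨ support-¬ ((¬𝔍 I) ∧𝔍 (¬𝔍 J)) x ⟩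
      not (support ((¬𝔍 I) ∧𝔍 (¬𝔍 J)) x)              ≡⟨ cong not (support-∧ (¬𝔍 I) (¬𝔍 J) x) ⟩
      not (support (¬𝔍 I) x ∧ support (¬𝔍 J) x)        ≡⟨ cong not (cong₂ _∧_ (support-¬ I x) (support-¬ J x)) ⟩
      not (not (support I x) ∧ not (support J x))      ≡⟨ not-∧-not (support I x) (support J x) ⟩
      support I x ∨ support J x                        ∎
      where open ≡-Reasoning

    -- Every subset of X is the support of the annihilator of its marking.
    preimage : (X → Bool) → 𝔍 X
    preimage g = Ann ｛ (λ y → mark (g y)) ｝ , Ann-closed _

    support-preimage : ∀ g → support (preimage g) ≗ g
    support-preimage g x =
      does-⇔ (⇔-trans (Supp-Ann-singleton (λ y → mark (g y))) (mark-U (T? (g x)))) lem (T? (g x))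

    support-isIso : IsBAIsoTo2^X support
    support-isIso = record
      { cong       = λ (I⊆J , J⊆I) x → does-⇔ (mk⇔ (Supp-mono I⊆J) (Supp-mono J⊆I)) lem lem
      ; injective  = λ {I} {J} same →
            ⊆-from-Supp (closedness J) (λ {x} → does-transport lem lem (same x))
          , ⊆-from-Supp (closedness I) (λ {x} → does-transport lem lem (sym (same x)))
      ; surjective = λ g → preimage g , support-preimage g
      ; hom-¬      = support-¬
      ; hom-∧      = support-∧
      ; hom-∨      = support-∨
      ; hom-0      = λ x → dec-false lem λ (a , a≡𝐔 , a≢U) → a≢U (a≡𝐔 x)
      ; hom-1      = λ x → dec-true lem ((λ _ → T) , tt , λ ())
      }

theorem4p14 : (X : Set) →
    IsBooleanAlgebra (_≈𝔍_ {X}) _∨𝔍_ _∧𝔍_ ¬𝔍_ 1𝔍 0𝔍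
    × (ExcludedMiddle 0ℓ → ∃ λ (f : 𝔍 X → (X → Bool)) → IsBAIsoTo2^X f)
    × Complete𝔍 X
theorem4p14 X =
    𝔍-isBooleanAlgebra
  , (λ lem → Representation.support lem , Representation.support-isIso lem)
  , 𝔍-complete
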